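{- For integers $s$ and $t$, there exist $M=f(s,t)$ and $N=g(s,t)$ such that for all $m\ge M$ and $n\ge N$, if a graph $G$ has $2m$ disjoint $n$-vertex sets $X_1,\ldots, X_m,Y_1,\ldots, Y_m$ such that each $X_i$ is a clique of $G$, $G[X_1\cup \cdots\cup X_m]$ is isomorphic to $mK_n$, and one of $K_n\oplus_{=} \overline{K_n}$, $K_n\oplus_{=} K_n$, $K_n\oplus_{\neq} \overline{K_n}$, $K_n\oplus_{\neq} K_n$ is isomorphic to all $G[X_i\cup Y_i]$, then there exist indices $1\le i_1<\cdots<i_s\le m$, subsets $X_1^*,\ldots, X_s^*$ of $X_{i_1},\ldots, X_{i_s}$ respectively, and subsets $Y_1^*,\ldots, Y_s^*$ of $Y_{i_1},\ldots, Y_{i_s}$ respectively, such that: (i) $|X_i^*|=|Y_i^*|=t$ for all $1\le i\le s$; (ii) one of $K_t\oplus_{=} \overline{K_t}$, $K_t\oplus_{=} K_t$, $K_t\oplus_{\neq} \overline{K_t}$, $K_t\oplus_{\neq} K_t$ is isomorphic to all $G[X_i^*\cup Y_i^*]$, $1\le i\le s$; (iii) $X_i^*$ is complete to $Y_j^*$ for all $i<j$, or $X_i^*$ is anti-complete to $Y_j^*$ for all $i<j$; (iv) $Y_i^*$ is complete to $X_j^*$ for all $i<j$, or $Y_i^*$ is anti-complete to $X_j^*$ for all $i<j$; (v) $Y_i^*$ is complete to $Y_j^*$ for all $i<j$, or $Y_i^*$ is anti-complete to $Y_j^*$ for all $i<j$. In other words, $G$ has an induced subgraph isomorphic to one of $(K_t\oplus_{=}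 K_t)^s_A$, $(K_t\oplus_{=} \overline{K_t})^s_A$, $(K_t\oplus_{\neq} K_t)^s_A$, $(K_t\oplus_{\neq} \overline{K_t})^s_A$ for some $0$-$1$ matrix $A=\begin{pmatrix}0&b\\c&d\end{pmatrix}$.
   Context: $\overline{K_n}$ is the edgeless graph on $n$ vertices and $mK_n$ the disjoint union of $m$ copies of $K_n$. A set $A$ is complete (resp. anti-complete) to a disjoint set $B$ if every vertex of $A$ is adjacent (resp. non-adjacent) to every vertex of $B$. For two $n$-vertex graphs $G,H$ on disjoint vertex sets with orderings $v_1,\dots,v_n$ and $w_1,\dots,w_n$, $G\oplus_{=}H$ (resp. $G\oplus_{\neq}H$) is the graph on $V(G)\cup V(H)$ inducing $G$ on $V(G)$ and $H$ on $V(H)$, in which $v_iw_j$ is an edge iff $i=j$ (resp. iff $i\neq j$). For $\odot\in\{\oplus_=,\oplus_{\neq}\}$, a positive integer $s$ and a $0$-$1$ matrix $A=\begin{pmatrix}a&b\\c&d\end{pmatrix}$, $(G\odot H)^s_A$ is the disjoint union of $s$ copies of $G\odot H$ with added edges such that for all $1\le i<j\le s$: the $i$-th copy of $G$ is complete to the $j$-th copy of $G$ if $a=1$ and anti-complete if $a=0$; the $i$-th copy of $G$ is complete to the $j$-th copy of $H$ if $b=1$ and anti-complete if $b=0$; the $i$-th copy of $H$ is complete to the $j$-th copy of $G$ if $c=1$ and anti-complete if $c=0$; the $i$-th copy of $H$ is complete to the $j$-th copy of $H$ if $d=1$ and anti-complete if $d=0$. -}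

module Defs where

open import Data.Nat using (ℕ)
open import Data.Fin using (Fin; _<_)
open import Data.Sum using (_⊎_; inj₁; inj₂; [_,_])
open import Data.Product using (Σ; _×_; _,_)
open import Data.Empty using (⊥)
open import Relation.Nullary using (¬_)
open import Relation.Binary.PropositionalEquality using (_≡_; _≢_)
open import Relation.Binary.Definitions using (Decidable)
open import Function.Bundles using (_↔_; Inverse; _⇔_)
open import Function.Definitions using (Injective)

record Graph : Set₁ where
  field
    order  : ℕ
    Adj    : Fin order → Fin order → Set
    dec    : Decidable Adj
    sym    : ∀ {u v} → Adj u v → Adj v u
    irrefl : ∀ {v} → ¬ Adj v v

open Graph public

Vtx : Graph → Set
Vtx G = Fin (order G)

-- A vertex set S of G given by an injective enumeration e : I → V(G)
-- (I is the index type of the set).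
InducedIso : (G : Graph) {I : Set} (e : I → Vtx G) {J : Set} (H : J → J → Set) → Set
InducedIso G {I} e {J} H =
  Σ (I ↔ J) λ f → ∀ a b → (Adj G (e a) (e b) ⇔ H (Inverse.to f a) (Inverse.to f b))

Kadj : (n : ℕ) → Fin n → Fin n → Set
Kadj n a b = a ≢ b

Kbaradj : (n : ℕ) → Fin n → Fin n → Set
Kbaradj n a b = ⊥

mKadj : (m n : ℕ) → Fin m × Fin n → Fin m × Fin n → Set
mKadj m n (i , a) (j , b) = (i ≡ j) × (a ≢ b)

-- G ⊕ H on Fin n ⊎ Fin n (left copy = V(G) with v_i = inj₁ i,
-- right copy = V(H) with w_j = inj₂ j); cross relation C v_i w_j.
oplus : (n : ℕ) (C GA HA : Fin n → Fin n → Set) → Fin n ⊎ Fin n → Fin n ⊎ Fin n → Set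
oplus n C GA HA (inj₁ a) (inj₁ b) = GA a b
oplus n C GA HA (inj₂ a) (inj₂ b) = HA a b
oplus n C GA HA (inj₁ a) (inj₂ b) = C a b
oplus n C GA HA (inj₂ a) (inj₁ b) = C b a

oplusEq oplusNeq : (n : ℕ) (GA HA : Fin n → Fin n → Set) → Fin n ⊎ Fin n → Fin n ⊎ Fin n → Set
oplusEq n = oplus n _≡_
oplusNeq n = oplus n _≢_

data PairType : Set where
  eqBar eqK neqBar neqK : PairType

pairGraph : PairType → (n : ℕ) → Fin n ⊎ Fin n → Fin n ⊎ Fin n → Set
pairGraph eqBar  n = oplusEq  n (Kadj n) (Kbaradj n)
pairGraph eqK    n = oplusEq  n (Kadj n) (Kadj n)
pairGraph neqBar n = oplusNeq n (Kadj n) (Kbaradj n)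
pairGraph neqK   n = oplusNeq n (Kadj n) (Kadj n)

joinEnum : {A : Set} {n : ℕ} → (Fin n → A) → (Fin n → A) → Fin n ⊎ Fin n → A
joinEnum f g = [ f , g ]

-- Disjointness of the 2m sets X_1..X_m, Y_1..Y_m each of which is injectively
-- enumerated: the combined enumeration of all of them is injective.
AllDisjoint : (G : Graph) {m n : ℕ} (x y : Fin m → Fin n → Vtx G) → Set
AllDisjoint G {m} {n} x y =
  Injective _≡_ _≡_ (λ (p : (Fin m × Fin n) ⊎ (Fin m × Fin n)) →
    [ (λ { (i , a) → x i a }) , (λ { (i , a) → y i a }) ] p)

Complete AntiComplete : (G : Graph) {t : ℕ} (A B : Fin t → Vtx G) → Set
Complete G A B = ∀ a b → Adj G (A a) (B b)
AntiComplete G A B = ∀ a b → ¬ Adj G (A a) (B b)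

Homog : (G : Graph) {s t : ℕ} (P Q : Fin s → Fin t → Vtx G) → Set
Homog G {s} P Q =
  (∀ (i j : Fin s) → i < j → Complete G (P i) (Q j))
  ⊎ (∀ (i j : Fin s) → i < j → AntiComplete G (P i) (Q j))

module Submission where

open import Defs
open import Data.Nat using (ℕ; _≤_)
open import Data.Fin using (Fin; _<_)
open import Data.Product using (Σ; _×_; _,_; proj₁; proj₂)
open import Data.Sum using (_⊎_)
open import Relation.Binary.PropositionalEquality using (_≡_; _≢_)
open import Function.Base using (_∘_)
open import Function.Definitions using (Injective)

open import Data.Nat as ℕ using (zero; suc; _+_; z≤n; s≤s)
import Data.Nat.Properties as ℕ
open import Data.Fin using (zero; suc; inject≤)
open import Data.Fin.Properties using (_≟_; <-cmp; <-irrefl; toℕ-inject≤)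
open import Data.Bool using (Bool; true; false; if_then_else_)
import Data.Sum as ⊎
open import Data.Sum using (inj₁; inj₂)
open import Data.Sum.Properties using (inj₁-injective)
open import Data.Empty using (⊥; ⊥-elim)
open import Relation.Nullary using (yes; no; does; proof)
open import Relation.Nullary.Reflects using (Reflects; invert)
open import Relation.Binary.Definitions using (tri<; tri≈; tri>)
import Relation.Binary.PropositionalEquality as ≡
open import Relation.Binary.PropositionalEquality using (refl; trans; cong; cong₂; subst)
open import Function.Bundles using (_⇔_; mk⇔; Equivalence; Inverse; Injection)
open import Function.Properties.Inverse using (↔-refl; ↔⇒↣)
open import Function.Properties.Equivalence using () renaming (refl to ⇔-refl; trans to ⇔-trans)

record Selection (a b : ℕ) : Set where
  constructor selection
  field
    pick       : Fin a → Fin b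
    increasing : ∀ i j → i < j → pick i < pick j

open Selection public

pick-injective : ∀ {a b} (σ : Selection a b) → Injective _≡_ _≡_ (pick σ)
pick-injective σ {i} {j} eq with <-cmp i j
... | tri< i<j _ _ = ⊥-elim (<-irrefl eq (increasing σ i j i<j))
... | tri≈ _ i≡j _ = i≡j
... | tri> _ _ j<i = ⊥-elim (<-irrefl (≡.sym eq) (increasing σ j i j<i))

idSel : ∀ {a} → Selection a a
idSel = selection (λ i → i) (λ i j i<j → i<j)

infixr 9 _∘ˢ_
_∘ˢ_ : ∀ {a b c} → Selection b c → Selection a b → Selection a c
σ ∘ˢ τ = selection (pick σ ∘ pick τ) (λ i j i<j → increasing σ _ _ (increasing τ i j i<j))

none : ∀ {b} → Selection 0 b
none = selection (λ ()) (λ ())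

prefix : ∀ {a b} → a ≤ b → Selection a b
prefix a≤b = selection (λ i → inject≤ i a≤b) increasing-inject≤
  where
  increasing-inject≤ : ∀ i j → i < j → inject≤ i a≤b < inject≤ j a≤b
  increasing-inject≤ i j i<j rewrite toℕ-inject≤ i a≤b | toℕ-inject≤ j a≤b = i<j

skipFirst : ∀ {a b} → Selection a b → Selection a (suc b)
skipFirst σ = selection (suc ∘ pick σ) (λ i j i<j → s≤s (increasing σ i j i<j))

keepFirst : ∀ {a b} → Selection a b → Selection (suc a) (suc b)
keepFirst σ = selection picked increasing′
  where
  picked : Fin (suc _) → Fin (suc _)
  picked zero    = zero
  picked (suc i) = suc (pick σ i)
  increasing′ : ∀ i j → i < j → picked i < picked j
  increasing′ zero    (suc j) _         = s≤s z≤n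
  increasing′ (suc i) (suc j) (s≤s i<j) = s≤s (increasing σ i j i<j)

Monochromatic : ∀ {C : Set} {n h} → (Fin n → C) → C → Selection h n → Set
Monochromatic c b σ = ∀ i → c (pick σ i) ≡ b

record MonoSub {C : Set} {n : ℕ} (c : Fin n → C) (h : ℕ) : Set where
  constructor monoSub
  field
    colour : C
    sub    : Selection h n
    mono   : Monochromatic c colour sub

record Pigeonhole (C : Set) : Set where
  field
    bound     : ℕ → ℕ
    monochrom : ∀ h (c : Fin (bound h) → C) → MonoSub c h

twoColour : ∀ {n} p q → p + q ≤ n → (c : Fin n → Bool) →
  Σ (Selection p n) (Monochromatic c true) ⊎ Σ (Selection q n) (Monochromatic c false)
twoColour zero q _ c = inj₁ (none , λ ())
twoColour (suc p) zero _ c = inj₂ (none , λ ())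
twoColour {suc n} (suc p) (suc q) (s≤s room) c with c zero in c₀
... | true with twoColour p (suc q) room (c ∘ suc)
...   | inj₁ (σ , mono) = inj₁ (keepFirst σ , λ { zero → c₀ ; (suc i) → mono i })
...   | inj₂ (σ , mono) = inj₂ (skipFirst σ , mono)
twoColour {suc n} (suc p) (suc q) (s≤s room) c | false
  with twoColour (suc p) q (subst (_≤ n) (ℕ.+-suc p q) room) (c ∘ suc)
...   | inj₁ (σ , mono) = inj₁ (skipFirst σ , mono)
...   | inj₂ (σ , mono) = inj₂ (keepFirst σ , λ { zero → c₀ ; (suc i) → mono i })

bool : Pigeonhole Bool
bool = record { bound = λ h → h + h ; monochrom = λ h c → fromTwo (twoColour h h ℕ.≤-refl c) }
  where
  fromTwo : ∀ {n h} {c : Fin n → Bool} →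
    Σ (Selection h n) (Monochromatic c true) ⊎ Σ (Selection h n) (Monochromatic c false) → MonoSub c h
  fromTwo (inj₁ (σ , mono)) = monoSub true σ mono
  fromTwo (inj₂ (σ , mono)) = monoSub false σ mono

-- Pigeonhole for pairs of colours: first make the first coordinate constant, then the second.
_×ᴾ_ : ∀ {C D : Set} → Pigeonhole C → Pigeonhole D → Pigeonhole (C × D)
pC ×ᴾ pD = record { bound = PC.bound ∘ PD.bound ; monochrom = monochrom }
  where
  module PC = Pigeonhole pC
  module PD = Pigeonhole pD
  monochrom : ∀ h c → MonoSub c h
  monochrom h c with PC.monochrom (PD.bound h) (proj₁ ∘ c)
  ... | monoSub c₁ σ mono₁ with PD.monochrom h (proj₂ ∘ c ∘ pick σ)
  ...   | monoSub d₁ τ mono₂ = monoSub (c₁ , d₁) (σ ∘ˢ τ) (λ i → cong₂ _,_ (mono₁ (pick τ i)) (mono₂ i))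

module BagRamsey {C : Set} (pigeonhole : Pigeonhole C) where

  open Pigeonhole pigeonhole

  iter : ℕ → ℕ → ℕ
  iter zero    h = h
  iter (suc L) h = bound (iter L h)

  -- Size of the first bag needed to homogenise it against r later bags, keeping
  -- h elements of the first bag and u elements of each later bag.
  starSize : ℕ → ℕ → ℕ → ℕ
  starSize u zero    h = h
  starSize u (suc r) h = iter (bound u) (starSize u r h)

  -- Number and size of bags sufficient for an L-element subfamily.
  bagCount : ℕ → ℕ
  bagCount zero    = zero
  bagCount (suc L) = suc (bound (bagCount L))

  bagSize : ℕ → ℕ → ℕ
  bagSize h zero    = zero
  bagSize h (suc L) = starSize (bagSize h L) (bound (bagCount L)) h + bound (bagSize h L)

  asFirst : ∀ h L → Selection (starSize (bagSize h L) (bound (bagCount L)) h) (bagSize h (suc L))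
  asFirst h L = prefix (ℕ.m≤m+n _ _)

  asLater : ∀ h L → Selection (bound (bagSize h L)) (bagSize h (suc L))
  asLater h L = prefix (ℕ.m≤n+m _ _)

  module _ {E : Set} (χ : E → E → C) where

    Homogeneous : ∀ {k l} → C → (Fin k → E) → (Fin l → E) → Set
    Homogeneous c f g = ∀ a b → χ (f a) (g b) ≡ c

    fixLeft : ∀ L h (f : Fin (iter L h) → E) (g : Fin L → E) →
      Σ (Selection h (iter L h)) λ σ → Σ (Fin L → C) λ col → ∀ a l → χ (f (pick σ a)) (g l) ≡ col l
    fixLeft zero    h f g = idSel , (λ ()) , (λ a ())
    fixLeft (suc L) h f g with monochrom (iter L h) (λ a → χ (f a) (g zero))
    ... | monoSub c₀ σ₀ mono₀ with fixLeft L h (f ∘ pick σ₀) (g ∘ suc)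
    ...   | σ , col , fixed = σ₀ ∘ˢ σ , (λ { zero → c₀ ; (suc l) → col l })
                            , λ { a zero → mono₀ (pick σ a) ; a (suc l) → fixed a l }

    record Star {u r h} (f : Fin (starSize u r h) → E) (rest : Fin r → Fin (bound u) → E) : Set where
      field
        first  : Selection h (starSize u r h)
        later  : Fin r → Selection u (bound u)
        colour : Fin r → C
        homog  : ∀ k → Homogeneous (colour k) (f ∘ pick first) (rest k ∘ pick (later k))

    star : ∀ u r h (f : Fin (starSize u r h) → E) (rest : Fin r → Fin (bound u) → E) → Star f rest
    star u zero    h f rest = record { first = idSel ; later = λ () ; colour = λ () ; homog = λ () }
    star u (suc r) h f rest with fixLeft (bound u) (starSize u r h) f (rest zero)
    ... | σ , col , fixed with monochrom u col | star u r h (f ∘ pick σ) (rest ∘ suc)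
    ...   | monoSub c₀ τ mono | S = record
      { first  = σ ∘ˢ Star.first S
      ; later  = λ { zero → τ ; (suc k) → Star.later S k }
      ; colour = λ { zero → c₀ ; (suc k) → Star.colour S k }
      ; homog  = λ { zero a b → trans (fixed (pick (Star.first S) a) (pick τ b)) (mono b)
                   ; (suc k) → Star.homog S k }
      }

    record Subfamily {K U} (L h : ℕ) (bags : Fin K → Fin U → E) (colour : Fin L → C) : Set where
      field
        bag    : Selection L K
        inBag  : Fin L → Selection h U
        homog  : ∀ i j → i < j →
          Homogeneous (colour i) (bags (pick bag i) ∘ pick (inBag i)) (bags (pick bag j) ∘ pick (inBag j))

    -- Homogenise the first bag against all later ones, keep the later bags towards
    -- which it has a common colour, and recurse on those.
    ordered : ∀ h L (bags : Fin (bagCount L) → Fin (bagSize h L) → E) →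
      Σ (Fin L → C) (Subfamily L h bags)
    ordered h zero    bags = (λ ()) , record { bag = none ; inBag = λ () ; homog = λ () }
    ordered h (suc L) bags
      with star (bagSize h L) (bound (bagCount L)) h (bags zero ∘ pick (asFirst h L))
                (λ k → bags (suc k) ∘ pick (asLater h L))
    ... | S with monochrom (bagCount L) (Star.colour S)
    ...   | monoSub c ψ mono with ordered h L (λ j → bags (suc (pick ψ j)) ∘ pick (asLater h L ∘ˢ Star.later S (pick ψ j)))
    ...     | col , F = colour′ , record { bag = bag′ ; inBag = inBag′ ; homog = homog′ }
      where
      open Subfamily F using () renaming (bag to θ; inBag to inBagF; homog to homogF)
      laterBag : Fin L → Fin (bound (bagCount L))
      laterBag l = pick ψ (pick θ l)
      colour′ : Fin (suc L) → C
      colour′ zero    = c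
      colour′ (suc l) = col l
      bag′ : Selection (suc L) (bagCount (suc L))
      bag′ = keepFirst (ψ ∘ˢ θ)
      inBag′ : Fin (suc L) → Selection h (bagSize h (suc L))
      inBag′ zero    = asFirst h L ∘ˢ Star.first S
      inBag′ (suc l) = asLater h L ∘ˢ Star.later S (laterBag l) ∘ˢ inBagF l
      homog′ : ∀ i j → i < j → Homogeneous (colour′ i) (bags (pick bag′ i) ∘ pick (inBag′ i)) (bags (pick bag′ j) ∘ pick (inBag′ j))
      homog′ zero    (suc l) _         a b = trans (Star.homog S (laterBag l) a (pick (inBagF l) b)) (mono (pick θ l))
      homog′ (suc i) (suc j) (s≤s i<j)     = homogF i j i<j

    -- Making the colour uniform over the first indices: ordered Ramsey for bags.
    ramsey : ∀ h s (bags : Fin (bagCount (bound s)) → Fin (bagSize h (bound s)) → E) →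
      Σ C λ c → Subfamily s h bags (λ _ → c)
    ramsey h s bags with ordered h (bound s) bags
    ... | col , F with monochrom s col
    ...   | monoSub c ψ mono = c , record
      { bag   = Subfamily.bag F ∘ˢ ψ
      ; inBag = Subfamily.inBag F ∘ pick ψ
      ; homog = λ i j i<j → subst (λ c′ → Homogeneous c′ _ _) (mono i) (Subfamily.homog F _ _ (increasing ψ i j i<j))
      }

≡⇒⇔ : ∀ {A B : Set} → A ≡ B → A ⇔ B
≡⇒⇔ refl = ⇔-refl

-- The pair graphs K_n ⊕ H are instances of a symmetric description: a cross
-- relation (⊕_= or ⊕_≠), and on each side a complete or edgeless graph.
cross : Bool → (n : ℕ) → Fin n → Fin n → Set
cross true  n = _≡_
cross false n = _≢_

inner : Bool → (n : ℕ) → Fin n → Fin n → Set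
inner true  = Kadj
inner false = Kbaradj

Pair : (c l r : Bool) (n : ℕ) → Fin n ⊎ Fin n → Fin n ⊎ Fin n → Set
Pair c l r n = oplus n (cross c n) (inner l n) (inner r n)

pairType : Bool → Bool → PairType
pairType true  false = eqBar
pairType true  true  = eqK
pairType false false = neqBar
pairType false true  = neqK

pairGraph-Pair : ∀ c r n → pairGraph (pairType c r) n ≡ Pair c true r n
pairGraph-Pair true  false n = refl
pairGraph-Pair true  true  n = refl
pairGraph-Pair false false n = refl
pairGraph-Pair false true  n = refl

classify : ∀ P → Σ Bool λ c → Σ Bool λ r → pairType c r ≡ P
classify eqBar  = true  , false , refl
classify eqK    = true  , true  , refl
classify neqBar = false , false , refl
classify neqK   = false , true  , refl

cross-sym : ∀ c {n} (a b : Fin n) → cross c n a b ⇔ cross c n b a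
cross-sym true  a b = mk⇔ ≡.sym ≡.sym
cross-sym false a b = mk⇔ ≡.≢-sym ≡.≢-sym

Pair-swap : ∀ c l r {n} (p q : Fin n ⊎ Fin n) → Pair c l r n (⊎.swap p) (⊎.swap q) ⇔ Pair c r l n p q
Pair-swap c l r (inj₁ a) (inj₁ b) = ⇔-refl
Pair-swap c l r (inj₁ a) (inj₂ b) = cross-sym c b a
Pair-swap c l r (inj₂ a) (inj₁ b) = cross-sym c a b
Pair-swap c l r (inj₂ a) (inj₂ b) = ⇔-refl

orient : ∀ {A : Set} → Bool → A ⊎ A → A ⊎ A
orient true  = λ p → p
orient false = ⊎.swap

Pair-orient : ∀ c l r o {n} (p q : Fin n ⊎ Fin n) →
  Pair c l r n (orient o p) (orient o q) ⇔ Pair c (if o then l else r) (if o then r else l) n p q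
Pair-orient c l r true  p q = ⇔-refl
Pair-orient c l r false p q = Pair-swap c l r p q

-- Cross and inner relations only compare indices, so they are invariant under injective relabelling.
cross-relabel : ∀ c {t n} {K : Fin t → Fin n} → Injective _≡_ _≡_ K → ∀ a b → cross c n (K a) (K b) ⇔ cross c t a b
cross-relabel true  K-inj a b = mk⇔ K-inj (cong _)
cross-relabel false K-inj a b = mk⇔ (λ Ka≢Kb a≡b → Ka≢Kb (cong _ a≡b)) (λ a≢b Ka≡Kb → a≢b (K-inj Ka≡Kb))

inner-relabel : ∀ l {t n} {K : Fin t → Fin n} → Injective _≡_ _≡_ K → ∀ a b → inner l n (K a) (K b) ⇔ inner l t a b
inner-relabel true  = cross-relabel false
inner-relabel false K-inj a b = ⇔-refl

Pair-relabel : ∀ c l r {t n} {K : Fin t → Fin n} → Injective _≡_ _≡_ K → ∀ p q →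
  Pair c l r n (⊎.map K K p) (⊎.map K K q) ⇔ Pair c l r t p q
Pair-relabel c l r K-inj (inj₁ a) (inj₁ b) = inner-relabel l K-inj a b
Pair-relabel c l r K-inj (inj₁ a) (inj₂ b) = cross-relabel c K-inj a b
Pair-relabel c l r K-inj (inj₂ a) (inj₁ b) = cross-relabel c K-inj b a
Pair-relabel c l r K-inj (inj₂ a) (inj₂ b) = inner-relabel r K-inj a b

-- In a pair graph with complete left side, a vertex h and its twin ⊎.swap h have no common
-- neighbour when adjacent (⊕_=), and are non-adjacent otherwise (⊕_≠).
twins-no-triangle : ∀ c r {n} (h k : Fin n ⊎ Fin n) →
  Pair c true r n h (⊎.swap h) → Pair c true r n h k → Pair c true r n (⊎.swap h) k → ⊥
twins-no-triangle false r (inj₁ a) k a≢a _ _ = a≢a refl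
twins-no-triangle false r (inj₂ a) k a≢a _ _ = a≢a refl
twins-no-triangle true r (inj₁ a) (inj₁ b) _ a≢b b≡a = a≢b (≡.sym b≡a)
twins-no-triangle true r (inj₂ a) (inj₁ b) _ b≡a a≢b = a≢b (≡.sym b≡a)
twins-no-triangle true true  (inj₁ a) (inj₂ b) _ a≡b a≢b = a≢b a≡b
twins-no-triangle true true  (inj₂ a) (inj₂ b) _ a≢b a≡b = a≢b a≡b
twins-no-triangle true false (inj₁ a) (inj₂ b) _ _ ()
twins-no-triangle true false (inj₂ a) (inj₂ b) _ () _

onLeft : ∀ {A : Set} → A ⊎ A → Bool
onLeft (inj₁ _) = true
onLeft (inj₂ _) = false

orient-onLeft : ∀ {A : Set} (h : A ⊎ A) → h ≡ orient (onLeft h) (inj₁ (⊎.reduce h))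
orient-onLeft (inj₁ _) = refl
orient-onLeft (inj₂ _) = refl

swap-orient : ∀ {A : Set} o (h : A ⊎ A) → ⊎.swap (orient o h) ≡ orient o (⊎.swap h)
swap-orient true  h = refl
swap-orient false h = refl

twin-distinct : ∀ {A : Set} (h : A ⊎ A) → h ≢ ⊎.swap h
twin-distinct (inj₁ _) ()
twin-distinct (inj₂ _) ()

third : ∀ {n} → 3 ≤ n → (a b : Fin n) → Σ (Fin n) λ z → z ≢ a × z ≢ b
third (s≤s (s≤s (s≤s _))) a b with zero ≟ a | zero ≟ b
... | no 0≢a   | no 0≢b = zero , 0≢a , 0≢b
... | yes refl | _ with suc zero ≟ b
...   | no 1≢b   = suc zero , (λ ()) , 1≢b
...   | yes refl = suc (suc zero) , (λ ()) , (λ ())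
third (s≤s (s≤s (s≤s _))) a b | no _ | yes refl with suc zero ≟ a
...   | no 1≢a   = suc zero , 1≢a , (λ ())
...   | yes refl = suc (suc zero) , (λ ()) , (λ ())

Induces : (G : Graph) {t : ℕ} → Bool → Bool → (X Y : Fin t → Vtx G) → Set
Induces G {t} c r X Y = ∀ p q → Adj G (joinEnum X Y p) (joinEnum X Y q) ⇔ Pair c true r t p q

joinEnum-map : ∀ G {t u} {X Y : Fin u → Vtx G} (f g : Fin t → Fin u) p q →
  Adj G (joinEnum (X ∘ f) (Y ∘ g) p) (joinEnum (X ∘ f) (Y ∘ g) q) ⇔ Adj G (joinEnum X Y (⊎.map f g p)) (joinEnum X Y (⊎.map f g q))
joinEnum-map G f g (inj₁ a) (inj₁ b) = ⇔-refl
joinEnum-map G f g (inj₁ a) (inj₂ b) = ⇔-refl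
joinEnum-map G f g (inj₂ a) (inj₁ b) = ⇔-refl
joinEnum-map G f g (inj₂ a) (inj₂ b) = ⇔-refl

Induces-restrict : ∀ G {t u} c r {X Y : Fin u → Vtx G} {k : Fin t → Fin u} →
  Injective _≡_ _≡_ k → Induces G c r X Y → Induces G c r (X ∘ k) (Y ∘ k)
Induces-restrict G c r {k = k} k-inj induces p q =
  ⇔-trans (joinEnum-map G k k p q) (⇔-trans (induces (⊎.map k k p) (⊎.map k k q)) (Pair-relabel c true r k-inj p q))

Induces⇒InducedIso : ∀ G {t} c r {X Y : Fin t → Vtx G} → Induces G c r X Y →
  InducedIso G (joinEnum X Y) (pairGraph (pairType c r) t)
Induces⇒InducedIso G {t} c r induces = subst (InducedIso G _) (≡.sym (pairGraph-Pair c r t)) (↔-refl , induces)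

-- u vertices of X and u vertices of Y inducing a pair graph with cross type c and X on the
-- complete side; the other side is complete or of type r, depending on the isomorphism.
record OrientedPair (G : Graph) {n : ℕ} (c : Bool) (X Y : Fin n → Vtx G) (u : ℕ) : Set where
  field
    rightType      : Bool
    xsel ysel      : Fin u → Fin n
    xsel-injective : Injective _≡_ _≡_ xsel
    ysel-injective : Injective _≡_ _≡_ ysel
    induces        : Induces G c rightType (X ∘ xsel) (Y ∘ ysel)

module Orientation (G : Graph) {n : ℕ} (three : 3 ≤ n) (X Y : Fin n → Vtx G)
  (clique : ∀ a b → a ≢ b → Adj G (X a) (X b)) (c r : Bool)
  (iso : InducedIso G (joinEnum X Y) (Pair c true r n)) where

  image : Fin n ⊎ Fin n → Fin n ⊎ Fin n
  image = Inverse.to (proj₁ iso)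

  image-adj : ∀ p q → Adj G (joinEnum X Y p) (joinEnum X Y q) ⇔ Pair c true r n (image p) (image q)
  image-adj = proj₂ iso

  image-injective : Injective _≡_ _≡_ image
  image-injective = Injection.injective (↔⇒↣ (proj₁ iso))

  clique-image : ∀ a b → a ≢ b → Pair c true r n (image (inj₁ a)) (image (inj₁ b))
  clique-image a b a≢b = Equivalence.to (image-adj (inj₁ a) (inj₁ b)) (clique a b a≢b)

  -- The twin of the image of an X-vertex is not the image of an X-vertex: otherwise
  -- the two together with a third X-vertex would form a triangle through twins.
  twin-not-X : ∀ a a′ → image (inj₁ a′) ≢ ⊎.swap (image (inj₁ a))
  twin-not-X a a′ eq with a ≟ a′
  ... | yes refl = twin-distinct (image (inj₁ a)) eq
  ... | no a≢a′ with third three a a′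
  ...   | z , z≢a , z≢a′ = twins-no-triangle c r (image (inj₁ a)) (image (inj₁ z))
          (subst (Pair c true r n (image (inj₁ a))) eq (clique-image a a′ a≢a′))
          (clique-image a z (≡.≢-sym z≢a))
          (subst (λ h → Pair c true r n h (image (inj₁ z))) eq (clique-image a′ z (≡.≢-sym z≢a′)))

  -- Hence that twin is the image of a Y-vertex, the partner of a.
  partner : ∀ a → Σ (Fin n) λ b → image (inj₂ b) ≡ ⊎.swap (image (inj₁ a))
  partner a with Inverse.from (proj₁ iso) (⊎.swap (image (inj₁ a))) | Inverse.strictlyInverseˡ (proj₁ iso) (⊎.swap (image (inj₁ a)))
  ... | inj₁ a′ | eq = ⊥-elim (twin-not-X a a′ eq)
  ... | inj₂ b  | eq = b , eq

  β : Fin n → Fin n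
  β = proj₁ ∘ partner

  β-injective : Injective _≡_ _≡_ β
  β-injective {a} {a′} βa≡βa′ = inj₁-injective (image-injective (twin-injective (begin
      ⊎.swap (image (inj₁ a))  ≡⟨ ≡.sym (proj₂ (partner a)) ⟩
      image (inj₂ (β a))       ≡⟨ cong (image ∘ inj₂) βa≡βa′ ⟩
      image (inj₂ (β a′))      ≡⟨ proj₂ (partner a′) ⟩
      ⊎.swap (image (inj₁ a′)) ∎)))
    where
    open ≡.≡-Reasoning
    twin-injective : ∀ {h h′ : Fin n ⊎ Fin n} → ⊎.swap h ≡ ⊎.swap h′ → h ≡ h′
    twin-injective {inj₁ _} {inj₁ _} refl = refl
    twin-injective {inj₂ _} {inj₂ _} refl = refl

  module OnOneSide {u} (σ : Fin u → Fin n) (σ-injective : Injective _≡_ _≡_ σ) (o : Bool)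
    (same-side : ∀ j → onLeft (image (inj₁ (σ j))) ≡ o) where

    K : Fin u → Fin n
    K j = ⊎.reduce (image (inj₁ (σ j)))

    image-X : ∀ j → image (inj₁ (σ j)) ≡ orient o (inj₁ (K j))
    image-X j = trans (orient-onLeft _) (cong (λ o′ → orient o′ (inj₁ (K j))) (same-side j))

    image-Y : ∀ j → image (inj₂ (β (σ j))) ≡ orient o (inj₂ (K j))
    image-Y j = trans (proj₂ (partner (σ j))) (trans (cong ⊎.swap (image-X j)) (swap-orient o (inj₁ (K j))))

    image-selected : ∀ p → image (⊎.map σ (β ∘ σ) p) ≡ orient o (⊎.map K K p)
    image-selected (inj₁ j) = image-X j
    image-selected (inj₂ j) = image-Y j

    K-injective : Injective _≡_ _≡_ K
    K-injective {j} {l} Kj≡Kl = σ-injective (inj₁-injective (image-injective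
      (trans (image-X j) (trans (cong (orient o ∘ inj₁) Kj≡Kl) (≡.sym (image-X l))))))

    through-image : ∀ p q → Adj G (joinEnum (X ∘ σ) (Y ∘ β ∘ σ) p) (joinEnum (X ∘ σ) (Y ∘ β ∘ σ) q)
                          ⇔ Pair c (if o then true else r) (if o then r else true) u p q
    through-image p q =
      ⇔-trans (joinEnum-map G σ (β ∘ σ) p q)
      (⇔-trans (image-adj (⊎.map σ (β ∘ σ) p) (⊎.map σ (β ∘ σ) q))
      (⇔-trans (≡⇒⇔ (cong₂ (Pair c true r n) (image-selected p) (image-selected q)))
      (⇔-trans (Pair-orient c true r o (⊎.map K K p) (⊎.map K K q))
               (Pair-relabel c (if o then true else r) (if o then r else true) K-injective p q))))

    -- Between X-vertices the clique itself is used, since on the far side the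
    -- pair graph may be edgeless.
    induces : Induces G c (if o then r else true) (X ∘ σ) (Y ∘ β ∘ σ)
    induces (inj₁ j) (inj₁ l) = mk⇔ (λ adj j≡l → irrefl G (subst (λ l′ → Adj G (X (σ j)) (X (σ l′))) (≡.sym j≡l) adj))
                                    (λ j≢l → clique (σ j) (σ l) (j≢l ∘ σ-injective))
    induces (inj₁ j) (inj₂ l) = through-image (inj₁ j) (inj₂ l)
    induces (inj₂ j) (inj₁ l) = through-image (inj₂ j) (inj₁ l)
    induces (inj₂ j) (inj₂ l) = through-image (inj₂ j) (inj₂ l)

  oriented : ∀ u → u + u ≤ n → OrientedPair G c X Y u
  oriented u 2u≤n with Pigeonhole.monochrom bool u (λ a → onLeft (image (inj₁ (pick (prefix 2u≤n) a))))
  ... | monoSub o τ same-side = record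
    { rightType      = if o then r else true
    ; xsel           = pick σ
    ; ysel           = β ∘ pick σ
    ; xsel-injective = pick-injective σ
    ; ysel-injective = λ eq → pick-injective σ (β-injective eq)
    ; induces        = OnOneSide.induces (pick σ) (pick-injective σ) o same-side
    }
    where
    σ : Selection u n
    σ = prefix 2u≤n ∘ˢ τ

record PairFamily (G : Graph) {m n : ℕ} (x y : Fin m → Fin n → Vtx G) (k u : ℕ) : Set where
  field
    pairs        : Selection k m
    xs ys        : Fin k → Fin u → Fin n
    xs-injective : ∀ i → Injective _≡_ _≡_ (xs i)
    ys-injective : ∀ i → Injective _≡_ _≡_ (ys i)
    crossType    : Bool
    rightType    : Bool
    induces      : ∀ i → Induces G crossType rightType (x (pick pairs i) ∘ xs i) (y (pick pairs i) ∘ ys i)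

  X* Y* : Fin k → Fin u → Vtx G
  X* i = x (pick pairs i) ∘ xs i
  Y* i = y (pick pairs i) ∘ ys i

sameType : ∀ G {m n} {x y : Fin m → Fin n → Vtx G} c k {u} → k + k ≤ m →
  (∀ i → OrientedPair G c (x i) (y i) u) → PairFamily G x y k u
sameType G {m} {n} {x} {y} c k {u} 2k≤m oriented
  with Pigeonhole.monochrom bool k (OrientedPair.rightType ∘ oriented ∘ pick (prefix 2k≤m))
... | monoSub b τ same = record
  { pairs        = σ
  ; xs           = OrientedPair.xsel ∘ oriented ∘ pick σ
  ; ys           = OrientedPair.ysel ∘ oriented ∘ pick σ
  ; xs-injective = OrientedPair.xsel-injective ∘ oriented ∘ pick σ
  ; ys-injective = OrientedPair.ysel-injective ∘ oriented ∘ pick σ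
  ; crossType    = c
  ; rightType    = b
  ; induces      = λ i → subst (λ b′ → Induces G c b′ (X i) (Y i)) (same i) (OrientedPair.induces (oriented (pick σ i)))
  }
  where
  σ : Selection k m
  σ = prefix 2k≤m ∘ˢ τ
  X Y : Fin k → Fin u → Vtx G
  X i = x (pick σ i) ∘ OrientedPair.xsel (oriented (pick σ i))
  Y i = y (pick σ i) ∘ OrientedPair.ysel (oriented (pick σ i))

orientedFamily : ∀ G {m n} (x y : Fin m → Fin n → Vtx G) k u → k + k ≤ m → u + u ≤ n → 3 ≤ n →
  (∀ i a b → a ≢ b → Adj G (x i a) (x i b)) →
  (Σ PairType λ P → ∀ i → InducedIso G (joinEnum (x i) (y i)) (pairGraph P n)) →
  PairFamily G x y k u
orientedFamily G {n = n} x y k u 2k≤m 2u≤n three clique (P , iso) with classify P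
... | c , r , refl = sameType G c k 2k≤m λ i →
  Orientation.oriented G three (x i) (y i) (clique i) c r
    (subst (InducedIso G (joinEnum (x i) (y i))) (pairGraph-Pair c r n) (iso i)) u 2u≤n

restrict : ∀ {G m n} {x y : Fin m → Fin n → Vtx G} {k u k′ u′} → PairFamily G x y k u →
  (θ : Selection k′ k) (inPair : Fin k′ → Selection u′ u) → PairFamily G x y k′ u′
restrict {G} F θ inPair = record
  { pairs        = pairs ∘ˢ θ
  ; xs           = λ i → xs (pick θ i) ∘ pick (inPair i)
  ; ys           = λ i → ys (pick θ i) ∘ pick (inPair i)
  ; xs-injective = λ i eq → pick-injective (inPair i) (xs-injective (pick θ i) eq)
  ; ys-injective = λ i eq → pick-injective (inPair i) (ys-injective (pick θ i) eq)
  ; crossType    = crossType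
  ; rightType    = rightType
  ; induces      = λ i → Induces-restrict G crossType rightType (pick-injective (inPair i)) (induces (pick θ i))
  }
  where open PairFamily F

adjacencies : (G : Graph) → Vtx G × Vtx G → Vtx G × Vtx G → Bool × Bool × Bool
adjacencies G (u , v) (u′ , v′) = does (dec G u v′) , does (dec G v u′) , does (dec G v v′)

adjacencyColours : Pigeonhole (Bool × Bool × Bool)
adjacencyColours = bool ×ᴾ (bool ×ᴾ bool)

open BagRamsey adjacencyColours using (bagCount; bagSize; ramsey; Subfamily)

decided-Homog : ∀ G {s t} (P Q : Fin s → Fin t → Vtx G) b →
  (∀ i j → i < j → ∀ a a′ → does (dec G (P i a) (Q j a′)) ≡ b) → Homog G P Q
decided-Homog G P Q true  decided = inj₁ λ i j i<j a a′ → invert (subst (Reflects _) (decided i j i<j a a′) (proof (dec G _ _)))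
decided-Homog G P Q false decided = inj₂ λ i j i<j a a′ → invert (subst (Reflects _) (decided i j i<j a a′) (proof (dec G _ _)))

HomogeneousSubpairs : (G : Graph) {m n : ℕ} (x y : Fin m → Fin n → Vtx G) (s t : ℕ) → Set
HomogeneousSubpairs G {m} {n} x y s t =
  Σ (Fin s → Fin m) λ idx →
  Σ (Fin s → Fin t → Fin n) λ xs →
  Σ (Fin s → Fin t → Fin n) λ ys →
    (∀ (i j : Fin s) → i < j → idx i < idx j)
    × (∀ (i : Fin s) → Injective _≡_ _≡_ (xs i) × Injective _≡_ _≡_ (ys i))
    × (Σ PairType λ P → ∀ (i : Fin s) →
         InducedIso G (joinEnum (x (idx i) ∘ xs i) (y (idx i) ∘ ys i)) (pairGraph P t))
    × Homog G (λ i → x (idx i) ∘ xs i) (λ i → y (idx i) ∘ ys i)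
    × Homog G (λ i → y (idx i) ∘ ys i) (λ i → x (idx i) ∘ xs i)
    × Homog G (λ i → y (idx i) ∘ ys i) (λ i → y (idx i) ∘ ys i)

homogeneousSubpairs : ∀ G {m n} (x y : Fin m → Fin n → Vtx G) s t →
  PairFamily G x y (bagCount (Pigeonhole.bound adjacencyColours s)) (bagSize t (Pigeonhole.bound adjacencyColours s)) →
  HomogeneousSubpairs G x y s t
homogeneousSubpairs G x y s t F with ramsey (adjacencies G) t s (λ i j → PairFamily.X* F i j , PairFamily.Y* F i j)
... | (b₁ , b₂ , b₃) , S =
  pick pairs , xs , ys , increasing pairs , (λ i → xs-injective i , ys-injective i) ,
  (pairType crossType rightType , λ i → Induces⇒InducedIso G crossType rightType (induces i)) ,
  decided-Homog G X* Y* b₁ (λ i j i<j a a′ → cong proj₁ (homog i j i<j a a′)) ,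
  decided-Homog G Y* X* b₂ (λ i j i<j a a′ → cong (proj₁ ∘ proj₂) (homog i j i<j a a′)) ,
  decided-Homog G Y* Y* b₃ (λ i j i<j a a′ → cong (proj₂ ∘ proj₂) (homog i j i<j a a′))
  where open PairFamily (restrict F (Subfamily.bag S) (Subfamily.inBag S))
        open Subfamily S using (homog)

-- Lemma 4.9.  Orient each pair by its isomorphism, keep half of the pairs with the same
-- induced pair graph, and apply ordered Ramsey to the (x, y) bags.
lemma4p9 : (s t : ℕ) → Σ ℕ λ M → Σ ℕ λ N →
    (m n : ℕ) → M ≤ m → N ≤ n →
    (G : Graph) (x y : Fin m → Fin n → Vtx G) →
    AllDisjoint G x y →
    (∀ (i : Fin m) (a b : Fin n) → a ≢ b → Adj G (x i a) (x i b)) →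
    InducedIso G (λ (p : Fin m × Fin n) → x (proj₁ p) (proj₂ p)) (mKadj m n) →
    (Σ PairType λ P → ∀ (i : Fin m) → InducedIso G (joinEnum (x i) (y i)) (pairGraph P n)) →
    Σ (Fin s → Fin m) λ idx →
    Σ (Fin s → Fin t → Fin n) λ xs →
    Σ (Fin s → Fin t → Fin n) λ ys →
      (∀ (i j : Fin s) → i < j → idx i < idx j)
      × (∀ (i : Fin s) → Injective _≡_ _≡_ (xs i) × Injective _≡_ _≡_ (ys i))
      × (Σ PairType λ P → ∀ (i : Fin s) →
           InducedIso G (joinEnum (x (idx i) ∘ xs i) (y (idx i) ∘ ys i)) (pairGraph P t))
      × Homog G (λ i → x (idx i) ∘ xs i) (λ i → y (idx i) ∘ ys i)
      × Homog G (λ i → y (idx i) ∘ ys i) (λ i → x (idx i) ∘ xs i)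
      × Homog G (λ i → y (idx i) ∘ ys i) (λ i → y (idx i) ∘ ys i)
lemma4p9 s t = count + count , (size + size) + 3 ,
  λ m n 2count≤m N≤n G x y _ clique _ pairTypes →
    homogeneousSubpairs G x y s t
      (orientedFamily G x y count size 2count≤m
        (ℕ.≤-trans (ℕ.m≤m+n (size + size) 3) N≤n) (ℕ.≤-trans (ℕ.m≤n+m 3 (size + size)) N≤n) clique pairTypes)
  where
  count size : ℕ
  count = bagCount (Pigeonhole.bound adjacencyColours s)
  size  = bagSize t (Pigeonhole.bound adjacencyColours s)
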